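{- Let $q$ be a prime power, $d\geq 2$, $n=d^2-1$, $s$ with $\gcd(s,n)=1$, $\sigma\colon x\mapsto x^{q^s}$ on $\mathbb{F}_{q^n}$, $a\in\mathbb{F}_{q^n}^*$ and $b=a^{ -\sigma^d\frac{\sigma^{d(d-1)}-1}{\sigma^d-1}}$. For $t\in\{0,\ldots,d-1\}$ let \[ c_{d-1,t}=\sum_{\substack{i_0,\ldots,i_t\geq 0\\ i_0+\cdots+i_t=d-1-t}}\left(\prod_{r=0}^{t}\prod_{j=1}^{i_r}a^{\sigma^{\,d(d-1-r-j-(i_0+\cdots+i_{r-1}))+d-1+r}}\right)\left(\prod_{u=0}^{t-1}b^{\sigma^{\,d(d-2-i_0-\cdots-i_u-u)+u+d-1}}\right) \] (empty sums $0$, empty products $1$). Then $c_{d-1,1}=\binom{d-1}{1}a^{ -1}$ and, for every $r\in\{2,\ldots,d-1\}$, \[ c_{d-1,r}=\binom{d-1}{r}\left(\prod_{v=1}^{r-1}b^{\sigma^{(r-v)d+v-1}}\right)a^{ -\sum_{i=1}^{r-1}\sigma^{id}}\,a^{ -1}. \]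
   Context: $a^{\sigma^j}=\sigma^j(a)$; $a^{ -\sum_i \sigma^{j_i}}=\prod_i\sigma^{j_i}(a)^{ -1}$; $b=\prod_{i=1}^{d-1}\sigma^{id}(a)^{ -1}$. Binomial coefficients are integers acting on $\mathbb{F}_{q^n}$. -}

module Defs where

open import Level using (Level; _⊔_)
open import Data.Nat as ℕ using (ℕ; zero; suc; _∸_; _≤_)
open import Data.Nat.Primality using (Prime)
open import Data.Fin using (Fin)
open import Data.Product using (Σ; ∃; _×_; _,_)
open import Data.List using (List; []; _∷_; map; concatMap; upTo; foldr; take)
open import Relation.Binary.PropositionalEquality using (_≡_)
open import Relation.Nullary using (¬_)
open import Algebra.Bundles using (CommutativeRing; Semiring)
import Algebra.Definitions.RawSemiring as RS
import Data.Nat.ListAction as ListAction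

IsPrimePower : ℕ → Set
IsPrimePower q = Σ ℕ λ p → Σ ℕ λ k → Prime p × q ≡ p ℕ.^ suc k

-- A field: a commutative ring with 0 ≠ 1 in which every nonzero element
-- has a multiplicative inverse, given by a total function _⁻¹
-- (its value at 0 is irrelevant).
record Field (c ℓ : Level) : Set (Level.suc (c ⊔ ℓ)) where
  field
    commutativeRing : CommutativeRing c ℓ
  open CommutativeRing commutativeRing public
  field
    _⁻¹     : Carrier → Carrier
    0≉1     : ¬ (0# ≈ 1#)
    inverseʳ : ∀ x → ¬ (x ≈ 0#) → (x * (x ⁻¹)) ≈ 1#

HasCard : ∀ {c ℓ} → Field c ℓ → ℕ → Set (c ⊔ ℓ)
HasCard F N = Σ (Fin N → Carrier) λ e →
    (∀ i j → e i ≈ e j → i ≡ j) × (∀ x → ∃ λ i → e i ≈ x)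
  where open Field F

-- weak compositions of m into k parts (lists of length k, entries ≥ 0, sum m)
comps : ℕ → ℕ → List (List ℕ)
comps zero zero = [] ∷ []
comps zero (suc m) = []
comps (suc k) m = concatMap (λ i → map (i ∷_) (comps k (m ∸ i))) (upTo (suc m))

at : List ℕ → ℕ → ℕ
at [] _ = 0
at (x ∷ xs) zero = x
at (x ∷ xs) (suc r) = at xs r

psum : List ℕ → ℕ → ℕ
psum xs r = ListAction.sum (take r xs)

module FieldOps {c′ ℓ′ : Level} (F : Field c′ ℓ′) where
  open Field F
  open RS (Semiring.rawSemiring semiring) public using (_^_; _×_)

  prodL : List Carrier → Carrier
  prodL = foldr _*_ 1#

  sumL : List Carrier → Carrier
  sumL = foldr _+_ 0#

  prodFrom : ℕ → ℕ → (ℕ → Carrier) → Carrier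
  prodFrom lo len f = prodL (map (λ j → f (lo ℕ.+ j)) (upTo len))

  iter : ℕ → (Carrier → Carrier) → Carrier → Carrier
  iter zero g x = x
  iter (suc m) g x = g (iter m g x)

  module Frob (q s : ℕ) where
    σ : Carrier → Carrier
    σ x = x ^ (q ℕ.^ s)

    -- a^{σ^m} = σ^m(a)
    σ^ : ℕ → Carrier → Carrier
    σ^ m = iter m σ

    module Coeffs (d : ℕ) (a : Carrier) where
      b : Carrier
      b = prodFrom 1 (d ∸ 1) (λ i → (σ^ (i ℕ.* d) a) ⁻¹)

      term : ℕ → List ℕ → Carrier
      term t is =
        prodFrom 0 (suc t) (λ r →
          prodFrom 1 (at is r) (λ j →
            σ^ (d ℕ.* (d ∸ 1 ∸ r ∸ j ∸ psum is r) ℕ.+ (d ∸ 1) ℕ.+ r) a))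
        * prodFrom 0 t (λ u →
            σ^ (d ℕ.* (d ∸ 2 ∸ psum is (suc u) ∸ u) ℕ.+ u ℕ.+ (d ∸ 1)) b)

      c : ℕ → Carrier
      c t = sumL (map (term t) (comps (suc t) (d ∸ 1 ∸ t)))

module Submission where

open import Defs
open import Level using (Level)
open import Data.Nat using (ℕ)
import Data.Nat as N
open import Data.Nat.GCD using (gcd)
open import Data.Nat.Combinatorics using (_C_)
import Data.Product as P
open import Relation.Binary.PropositionalEquality using (_≡_)
open import Relation.Nullary using (¬_)
import Data.Nat.Properties as N
open import Data.Nat.Primality using (prime⇒nonZero)
import Relation.Binary.PropositionalEquality as ≡
import Algebra.Properties.Monoid.Mult as Mult
open import Algebra.Bundles using (CommutativeMonoid)

-- Write e = d - 1, so that n = e + e d, and g k = a^{σ^{dk}}. Every x satisfies x^{qⁿ} = x, so σⁿ = id;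
-- together with d² = 1 + n this gives a^{σ^m} = g (d m) and makes g n-periodic. In these terms b^{σ^m}
-- is the inverse of the run g (dm + 1) ⋯ g (dm + e), and a summand of c_{d-1,t}, indexed by a
-- composition i₀ + ⋯ + i_t = e - t, is a product of runs of lengths i₀, …, i_t and of t inverses of
-- runs of length e. Neighbouring factors telescope, leaving the inverse of the single run
-- g n ⋯ g (n + t + (t-1)e - 1). The closed form is the inverse of the same run, so every summand
-- equals it and c_{d-1,t} is binom(d-1, t) times it.

module WeakCompositions where

  open import Data.Nat
  open import Data.Nat.Properties
  open import Data.Nat.Combinatorics using (nCn≡1; nCk+nC[k+1]≡[n+1]C[k+1])
  open import Data.List using (List; []; _∷_; map; concatMap; upTo; applyUpTo; length)
  open import Data.List.Properties using (length-++; length-map; map-applyUpTo; map-cong)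
  open import Data.List.Relation.Unary.All as All using (All; []; _∷_)
  open import Data.List.Relation.Unary.All.Properties using (map⁺; concat⁺; applyUpTo⁺₁)
  open import Data.Nat.ListAction using (sum)
  open import Relation.Binary.PropositionalEquality
  open import Function using (_∘_)

  length-concatMap : ∀ {A B : Set} (f : A → List B) xs → length (concatMap f xs) ≡ sum (map (length ∘ f) xs)
  length-concatMap f [] = refl
  length-concatMap f (x ∷ xs) = trans (length-++ (f x)) (cong (length (f x) +_) (length-concatMap f xs))

  length-comps-suc : ∀ k m → length (comps (suc k) m) ≡ sum (applyUpTo (λ i → length (comps k (m ∸ i))) (suc m))
  length-comps-suc k m = begin
    length (comps (suc k) m)
      ≡⟨ length-concatMap (λ i → map (i ∷_) (comps k (m ∸ i))) (upTo (suc m)) ⟩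
    sum (map (λ i → length (map (i ∷_) (comps k (m ∸ i)))) (upTo (suc m)))
      ≡⟨ cong sum (map-cong (λ i → length-map (i ∷_) (comps k (m ∸ i))) (upTo (suc m))) ⟩
    sum (map (λ i → length (comps k (m ∸ i))) (upTo (suc m)))
      ≡⟨ cong sum (map-applyUpTo (λ i → i) _ (suc m)) ⟩
    sum (applyUpTo (λ i → length (comps k (m ∸ i))) (suc m)) ∎
    where open ≡-Reasoning

  length-comps-pascal : ∀ k m → length (comps (suc k) (suc m)) ≡ length (comps k (suc m)) + length (comps (suc k) m)
  length-comps-pascal k m = trans (length-comps-suc k (suc m)) (cong (length (comps k (suc m)) +_) (sym (length-comps-suc k m)))

  length-comps : ∀ k m → length (comps (suc k) m) ≡ (m + k) C k
  length-comps zero zero = refl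
  length-comps zero (suc m) = trans (length-comps-pascal zero m) (length-comps zero m)
  length-comps (suc k) zero = begin
    length (comps (suc (suc k)) 0)  ≡⟨ trans (length-comps-suc (suc k) 0) (+-identityʳ _) ⟩
    length (comps (suc k) 0)        ≡⟨ length-comps k 0 ⟩
    k C k                           ≡⟨ trans (nCn≡1 k) (sym (nCn≡1 (suc k))) ⟩
    suc k C suc k                   ∎
    where open ≡-Reasoning
  length-comps (suc k) (suc m) = begin
    length (comps (suc (suc k)) (suc m))                      ≡⟨ length-comps-pascal (suc k) m ⟩
    length (comps (suc k) (suc m)) + length (comps (suc (suc k)) m) ≡⟨ cong₂ _+_ (length-comps k (suc m)) (length-comps (suc k) m) ⟩
    (suc m + k) C k + (m + suc k) C suc k                     ≡⟨ cong (λ x → x C k + (m + suc k) C suc k) (sym (+-suc m k)) ⟩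
    (m + suc k) C k + (m + suc k) C suc k                     ≡⟨ nCk+nC[k+1]≡[n+1]C[k+1] (m + suc k) k ⟩
    (suc m + suc k) C suc k                                   ∎
    where open ≡-Reasoning

  comps-sum : ∀ k m → All (λ is → sum is ≡ m) (comps k m)
  comps-sum zero zero = refl ∷ []
  comps-sum zero (suc m) = []
  comps-sum (suc k) m = concat⁺ (map⁺ (applyUpTo⁺₁ (λ i → i) (suc m) λ {i} i≤m →
    map⁺ (All.map (λ sum≡ → trans (cong (i +_) sum≡) (m+[n∸m]≡n (s≤s⁻¹ i≤m))) (comps-sum k (m ∸ i)))))

  comps-length : ∀ k m → All (λ is → length is ≡ k) (comps k m)
  comps-length zero zero = refl ∷ []
  comps-length zero (suc m) = []
  comps-length (suc k) m = concat⁺ (map⁺ (applyUpTo⁺₁ (λ i → i) (suc m) λ {i} _ →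
    map⁺ (All.map (cong suc) (comps-length k (m ∸ i)))))

  psum-suc : ∀ is r → psum is (suc r) ≡ psum is r + at is r
  psum-suc [] zero = refl
  psum-suc [] (suc r) = refl
  psum-suc (x ∷ is) zero = +-comm x 0
  psum-suc (x ∷ is) (suc r) = trans (cong (x +_) (psum-suc is r)) (sym (+-assoc x _ _))

  psum-mono : ∀ is {r r′} → r ≤ r′ → psum is r ≤ psum is r′
  psum-mono is z≤n = z≤n
  psum-mono [] (s≤s r≤r′) = z≤n
  psum-mono (x ∷ is) (s≤s r≤r′) = +-monoʳ-≤ x (psum-mono is r≤r′)

  psum-length : ∀ is → psum is (length is) ≡ sum is
  psum-length [] = refl
  psum-length (x ∷ is) = cong (x +_) (psum-length is)

module NatArithmetic where

  open import Data.Nat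
  open import Data.Nat.Properties
  open import Data.Nat.Tactic.RingSolver using (solve-∀)
  open import Data.List using (applyUpTo)
  open import Data.Nat.ListAction using (sum)
  open import Data.Product using (Σ; _,_)
  open import Relation.Binary.PropositionalEquality
  open import Function using (_∘_)

  ∸-∸-∸-+-+-+ : ∀ {m} x y z → x + y + z ≤ m → m ∸ x ∸ y ∸ z + x + y + z ≡ m
  ∸-∸-∸-+-+-+ {m} x y z x+y+z≤m = begin
    m ∸ x ∸ y ∸ z + x + y + z     ≡⟨ reassoc (m ∸ x ∸ y ∸ z) x y z ⟩
    m ∸ x ∸ y ∸ z + (x + y + z)   ≡⟨ cong (_+ (x + y + z)) (trans (cong (_∸ z) (∸-+-assoc m x y)) (∸-+-assoc m (x + y) z)) ⟩
    m ∸ (x + y + z) + (x + y + z) ≡⟨ m∸n+n≡m x+y+z≤m ⟩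
    m                             ∎
    where
    open ≡-Reasoning
    reassoc : ∀ w x y z → w + x + y + z ≡ w + (x + y + z)
    reassoc = solve-∀

  +-≤-split : ∀ {x y t m} → x ≤ t → y ≤ m ∸ t → t ≤ m → x + y ≤ m
  +-≤-split {x} {y} {t} {m} x≤t y≤m∸t t≤m = ≤-trans (+-mono-≤ x≤t y≤m∸t) (≤-reflexive (m+[n∸m]≡n t≤m))

  sum-lengths-telescope : ∀ k (s len : ℕ → ℕ) → (∀ u → u < k → s u + len u ≡ s (suc u)) → s 0 + sum (applyUpTo len k) ≡ s k
  sum-lengths-telescope zero s len _ = +-identityʳ (s 0)
  sum-lengths-telescope (suc k) s len adjacent = begin
    s 0 + (len 0 + sum (applyUpTo (len ∘ suc) k)) ≡⟨ sym (+-assoc (s 0) (len 0) _) ⟩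
    s 0 + len 0 + sum (applyUpTo (len ∘ suc) k)   ≡⟨ cong (_+ sum (applyUpTo (len ∘ suc) k)) (adjacent 0 (s≤s z≤n)) ⟩
    s 1 + sum (applyUpTo (len ∘ suc) k)           ≡⟨ sum-lengths-telescope k (s ∘ suc) (len ∘ suc) (λ u u<k → adjacent (suc u) (s≤s u<k)) ⟩
    s (suc k)                                     ∎
    where open ≡-Reasoning

  infix 4 _≡_[mod_]
  _≡_[mod_] : ℕ → ℕ → ℕ → Set
  x ≡ y [mod n ] = Σ ℕ λ i → Σ ℕ λ j → x + i * n ≡ y + j * n

  *-preserves-≡[mod] : ∀ c {x y n} → x ≡ y [mod n ] → c * x ≡ c * y [mod n ]
  *-preserves-≡[mod] c {x} {y} {n} (i , j , eq) = c * i , c * j , (begin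
    c * x + c * i * n   ≡⟨ cong (c * x +_) (*-assoc c i n) ⟩
    c * x + c * (i * n) ≡⟨ sym (*-distribˡ-+ c x (i * n)) ⟩
    c * (x + i * n)     ≡⟨ cong (c *_) eq ⟩
    c * (y + j * n)     ≡⟨ *-distribˡ-+ c y (j * n) ⟩
    c * y + c * (j * n) ≡⟨ cong (c * y +_) (sym (*-assoc c j n)) ⟩
    c * y + c * j * n   ∎)
    where open ≡-Reasoning

  +ʳ-preserves-≡[mod] : ∀ k {x y n} → x ≡ y [mod n ] → x + k ≡ y + k [mod n ]
  +ʳ-preserves-≡[mod] k {x} {y} {n} (i , j , eq) = i , j , (begin
    x + k + i * n   ≡⟨ +-assoc x k (i * n) ⟩
    x + (k + i * n) ≡⟨ cong (x +_) (+-comm k (i * n)) ⟩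
    x + (i * n + k) ≡⟨ sym (+-assoc x (i * n) k) ⟩
    x + i * n + k   ≡⟨ cong (_+ k) eq ⟩
    y + j * n + k   ≡⟨ +-assoc y (j * n) k ⟩
    y + (j * n + k) ≡⟨ cong (y +_) (+-comm (j * n) k) ⟩
    y + (k + j * n) ≡⟨ sym (+-assoc y k (j * n)) ⟩
    y + k + j * n   ∎)
    where open ≡-Reasoning

  module IndexArithmetic (e : ℕ) where

    -- Every congruence below comes from d * d ≡ 1 + n.
    d n : ℕ
    d = suc e
    n = e + e * d

    d*[d*m]≡m : ∀ m → d * (d * m) ≡ m [mod n ]
    d*[d*m]≡m m = 0 , m , identity e m
      where
      identity : ∀ e m → suc e * (suc e * m) + 0 * (e + e * suc e) ≡ m + m * (e + e * suc e)
      identity = solve-∀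

    n+k≡k : ∀ k → n + k ≡ k [mod n ]
    n+k≡k k = 0 , 1 , identity n k
      where
      identity : ∀ n k → n + k + 0 * n ≡ k + 1 * n
      identity = solve-∀

    σ^b-index : ∀ m k → d * (m + suc k * d) ≡ d * m + 1 + k [mod n ]
    σ^b-index m k = 0 , suc k , identity e m k
      where
      identity : ∀ e m k → suc e * (m + suc k * suc e) + 0 * (e + e * suc e) ≡ suc e * m + 1 + k + suc k * (e + e * suc e)
      identity = solve-∀

    closedForm-index : ∀ c v → d * (c * d + v) + 1 ≡ n + suc (c + v) + v * e [mod n ]
    closedForm-index c v = 1 , c , identity e c v
      where
      identity : ∀ e c v → suc e * (c * suc e + v) + 1 + 1 * (e + e * suc e) ≡ e + e * suc e + suc (c + v) + v * e + c * (e + e * suc e)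
      identity = solve-∀

    block-index : ∀ w r j P k s → w + r + suc j + P ≡ e → s + (P + (k + suc j)) ≡ n + e * r →
                  d * (d * w + e + r) ≡ s + k [mod n ]
    block-index w r j P k s w+r+j+P≡e s+P+k+j≡ = 0 , w , +-cancelʳ-≡ (P + suc j) _ _ (begin
      d * (d * w + e + r) + 0 * n + (P + suc j) ≡⟨ subst Goal w+r+j+P≡e (identity w r j P) ⟩
      n + e * r + w * n                        ≡⟨ cong (_+ w * n) (sym s+P+k+j≡) ⟩
      s + (P + (k + suc j)) + w * n            ≡⟨ rearrange s P k j (w * n) ⟩
      s + k + w * n + (P + suc j)              ∎)
      where
      open ≡-Reasoning
      Goal : ℕ → Set
      Goal e = suc e * (suc e * w + e + r) + 0 * (e + e * suc e) + (P + suc j) ≡ e + e * suc e + e * r + w * (e + e * suc e)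
      identity : ∀ w r j P → let e = w + r + suc j + P in
        suc e * (suc e * w + e + r) + 0 * (e + e * suc e) + (P + suc j) ≡ e + e * suc e + e * r + w * (e + e * suc e)
      identity = solve-∀
      rearrange : ∀ s P k j x → s + (P + (k + suc j)) + x ≡ s + k + x + (P + suc j)
      rearrange = solve-∀

    gap-index : ∀ v P u s → v + 1 + P + u ≡ e → s + P ≡ n + e * u → d * (d * v + u + e) + 1 ≡ s [mod n ]
    gap-index v P u s v+1+P+u≡e s+P≡ = 0 , v , +-cancelʳ-≡ P _ _ (begin
      d * (d * v + u + e) + 1 + 0 * n + P ≡⟨ subst Goal v+1+P+u≡e (identity v P u) ⟩
      n + e * u + v * n                  ≡⟨ cong (_+ v * n) (sym s+P≡) ⟩
      s + P + v * n                      ≡⟨ rearrange s P (v * n) ⟩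
      s + v * n + P                      ∎)
      where
      open ≡-Reasoning
      Goal : ℕ → Set
      Goal e = suc e * (suc e * v + u + e) + 1 + 0 * (e + e * suc e) + P ≡ e + e * suc e + e * u + v * (e + e * suc e)
      identity : ∀ v P u → let e = v + 1 + P + u in
        suc e * (suc e * v + u + e) + 1 + 0 * (e + e * suc e) + P ≡ e + e * suc e + e * u + v * (e + e * suc e)
      identity = solve-∀
      rearrange : ∀ s P x → s + P + x ≡ s + x + P
      rearrange = solve-∀

    next-start : ∀ u s s′ P i ℓ → s + P ≡ n + e * u → s′ + (P + i) ≡ n + e * suc u → ℓ + i ≡ e → s + ℓ ≡ s′
    next-start u s s′ P i ℓ s+P≡ s′+P+i≡ ℓ+i≡e = +-cancelʳ-≡ (P + i) _ _ (begin
      s + ℓ + (P + i)       ≡⟨ rearrange s ℓ P i ⟩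
      s + P + (ℓ + i)       ≡⟨ cong₂ _+_ s+P≡ ℓ+i≡e ⟩
      n + e * u + e         ≡⟨ distrib n e u ⟩
      n + e * suc u         ≡⟨ sym s′+P+i≡ ⟩
      s′ + (P + i)          ∎)
      where
      open ≡-Reasoning
      rearrange : ∀ s ℓ P i → s + ℓ + (P + i) ≡ s + P + (ℓ + i)
      rearrange = solve-∀
      distrib : ∀ n e u → n + e * u + e ≡ n + e * suc u
      distrib = solve-∀

    last-start : ∀ t s P → s + P ≡ n + e * suc t → P + suc t ≡ e → s ≡ n + (suc t + t * e)
    last-start t s P s+P≡ P+t≡e = +-cancelʳ-≡ P _ _ (begin
      s + P                      ≡⟨ s+P≡ ⟩
      n + e * suc t              ≡⟨ distrib n e t ⟩
      n + t * e + e              ≡⟨ cong (n + t * e +_) (sym P+t≡e) ⟩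
      n + t * e + (P + suc t)    ≡⟨ rearrange n t e P ⟩
      n + (suc t + t * e) + P    ∎)
      where
      open ≡-Reasoning
      distrib : ∀ n e t → n + e * suc t ≡ n + t * e + e
      distrib = solve-∀
      rearrange : ∀ n t e P → n + t * e + (P + suc t) ≡ n + (suc t + t * e) + P
      rearrange = solve-∀

module RangeProducts {c ℓ : Level} (M : CommutativeMonoid c ℓ) where

  open import Data.Nat using (ℕ; zero; suc; _∸_; _<_; z≤n; s≤s)
  open import Data.List using (applyUpTo)
  open import Data.Nat.ListAction using (sum)
  open import Relation.Binary.PropositionalEquality as ≡ using (_≡_)
  open import Function using (_∘_)

  open CommutativeMonoid M
  open import Algebra.Properties.CommutativeSemigroup commutativeSemigroup using (interchange)
  open import Relation.Binary.Reasoning.Setoid setoid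

  ∏< : ℕ → (ℕ → Carrier) → Carrier
  ∏< zero h = ε
  ∏< (suc n) h = h 0 ∙ ∏< n (h ∘ suc)

  ∏<-cong : ∀ n {h h′ : ℕ → Carrier} → (∀ j → j < n → h j ≈ h′ j) → ∏< n h ≈ ∏< n h′
  ∏<-cong zero h≈h′ = refl
  ∏<-cong (suc n) h≈h′ = ∙-cong (h≈h′ 0 (s≤s z≤n)) (∏<-cong n (λ j j<n → h≈h′ (suc j) (s≤s j<n)))

  ∏<-identity : ∀ n (h : ℕ → Carrier) → (∀ j → j < n → h j ≈ ε) → ∏< n h ≈ ε
  ∏<-identity zero h h≈ε = refl
  ∏<-identity (suc n) h h≈ε =
    trans (∙-cong (h≈ε 0 (s≤s z≤n)) (∏<-identity n (h ∘ suc) (λ j j<n → h≈ε (suc j) (s≤s j<n)))) (identityˡ ε)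

  ∏<-+ : ∀ m n h → ∏< (m N.+ n) h ≈ ∏< m h ∙ ∏< n (λ j → h (m N.+ j))
  ∏<-+ zero n h = sym (identityˡ _)
  ∏<-+ (suc m) n h = trans (∙-congˡ (∏<-+ m n (h ∘ suc))) (sym (assoc _ _ _))

  ∏<-snoc : ∀ n h → ∏< (suc n) h ≈ ∏< n h ∙ h n
  ∏<-snoc n h = begin
    ∏< (suc n) h                       ≡⟨ ≡.cong (λ m → ∏< m h) (N.+-comm 1 n) ⟩
    ∏< (n N.+ 1) h                     ≈⟨ ∏<-+ n 1 h ⟩
    ∏< n h ∙ (h (n N.+ 0) ∙ ε)          ≈⟨ ∙-congˡ (identityʳ _) ⟩
    ∏< n h ∙ h (n N.+ 0)                ≡⟨ ≡.cong (λ m → ∏< n h ∙ h m) (N.+-identityʳ n) ⟩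
    ∏< n h ∙ h n                       ∎

  ∏<-distrib : ∀ n f g → ∏< n (λ j → f j ∙ g j) ≈ ∏< n f ∙ ∏< n g
  ∏<-distrib zero f g = sym (identityˡ ε)
  ∏<-distrib (suc n) f g = trans (∙-congˡ (∏<-distrib n (f ∘ suc) (g ∘ suc))) (interchange _ _ _ _)

  ∏<-reverse : ∀ n h → ∏< n (λ j → h (n ∸ 1 ∸ j)) ≈ ∏< n h
  ∏<-reverse zero h = refl
  ∏<-reverse (suc n) h = begin
    h n ∙ ∏< n (λ j → h (n ∸ suc j))   ≈⟨ ∙-congˡ (∏<-cong n (λ j _ → reflexive (≡.cong h (≡.sym (N.∸-+-assoc n 1 j))))) ⟩
    h n ∙ ∏< n (λ j → h (n ∸ 1 ∸ j))   ≈⟨ ∙-congˡ (∏<-reverse n h) ⟩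
    h n ∙ ∏< n h                       ≈⟨ comm _ _ ⟩
    ∏< n h ∙ h n                       ≈⟨ sym (∏<-snoc n h) ⟩
    ∏< (suc n) h                       ∎

  module Intervals (h : ℕ → Carrier) where

    ∏[_,+_⟩ : ℕ → ℕ → Carrier
    ∏[ L ,+ len ⟩ = ∏< len (λ k → h (L N.+ k))

    ∏[,+⟩-+ : ∀ L m n → ∏[ L ,+ m N.+ n ⟩ ≈ ∏[ L ,+ m ⟩ ∙ ∏[ L N.+ m ,+ n ⟩
    ∏[,+⟩-+ L m n = trans (∏<-+ m n _) (∙-congˡ (∏<-cong n (λ j _ → reflexive (≡.cong h (≡.sym (N.+-assoc L m j))))))

    ∏[,+⟩-blocks : ∀ k e L → ∏[ L ,+ k N.* e ⟩ ≈ ∏< k (λ v → ∏[ L N.+ v N.* e ,+ e ⟩)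
    ∏[,+⟩-blocks zero e L = refl
    ∏[,+⟩-blocks (suc k) e L = begin
      ∏[ L ,+ e N.+ k N.* e ⟩                                 ≈⟨ ∏[,+⟩-+ L e (k N.* e) ⟩
      ∏[ L ,+ e ⟩ ∙ ∏[ L N.+ e ,+ k N.* e ⟩                     ≈⟨ ∙-cong (reflexive (≡.cong ∏[_,+ e ⟩ (≡.sym (N.+-identityʳ L)))) (∏[,+⟩-blocks k e (L N.+ e)) ⟩
      ∏[ L N.+ 0 ,+ e ⟩ ∙ ∏< k (λ v → ∏[ L N.+ e N.+ v N.* e ,+ e ⟩) ≈⟨ ∙-congˡ (∏<-cong k (λ v _ → reflexive (≡.cong ∏[_,+ e ⟩ (N.+-assoc L e (v N.* e))))) ⟩
      ∏[ L N.+ 0 ,+ e ⟩ ∙ ∏< k (λ v → ∏[ L N.+ suc v N.* e ,+ e ⟩) ∎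

    ∏[,+⟩-telescope : ∀ k (x : ℕ → Carrier) (s len : ℕ → ℕ) →
      (∀ u → u < k → s u N.+ len u ≡ s (suc u)) →
      (∀ u → u < k → x u ∙ ∏[ s u ,+ len u ⟩ ≈ ε) →
      ∏< k x ∙ ∏[ s 0 ,+ sum (applyUpTo len k) ⟩ ≈ ε
    ∏[,+⟩-telescope zero x s len _ _ = identityˡ ε
    ∏[,+⟩-telescope (suc k) x s len adjacent cancels = begin
      (x 0 ∙ ∏< k (x ∘ suc)) ∙ ∏[ s 0 ,+ len 0 N.+ rest ⟩
        ≈⟨ ∙-congˡ (∏[,+⟩-+ (s 0) (len 0) rest) ⟩
      (x 0 ∙ ∏< k (x ∘ suc)) ∙ (∏[ s 0 ,+ len 0 ⟩ ∙ ∏[ s 0 N.+ len 0 ,+ rest ⟩)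
        ≈⟨ interchange _ _ _ _ ⟩
      (x 0 ∙ ∏[ s 0 ,+ len 0 ⟩) ∙ (∏< k (x ∘ suc) ∙ ∏[ s 0 N.+ len 0 ,+ rest ⟩)
        ≡⟨ ≡.cong (λ L → (x 0 ∙ ∏[ s 0 ,+ len 0 ⟩) ∙ (∏< k (x ∘ suc) ∙ ∏[ L ,+ rest ⟩)) (adjacent 0 (s≤s z≤n)) ⟩
      (x 0 ∙ ∏[ s 0 ,+ len 0 ⟩) ∙ (∏< k (x ∘ suc) ∙ ∏[ s 1 ,+ rest ⟩)
        ≈⟨ ∙-cong (cancels 0 (s≤s z≤n)) (∏[,+⟩-telescope k (x ∘ suc) (s ∘ suc) (len ∘ suc)
             (λ u u<k → adjacent (suc u) (s≤s u<k)) (λ u u<k → cancels (suc u) (s≤s u<k))) ⟩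
      ε ∙ ε
        ≈⟨ identityˡ ε ⟩
      ε ∎
      where rest = sum (applyUpTo (len ∘ suc) k)

  ∏<-inverse : ∀ n (f g : ℕ → Carrier) → (∀ j → j < n → f j ∙ g j ≈ ε) → ∏< n f ∙ ∏< n g ≈ ε
  ∏<-inverse n f g fg≈ε = trans (sym (∏<-distrib n f g)) (∏<-identity n _ fg≈ε)

module FieldProperties {c ℓ : Level} (F : Field c ℓ) where

  open import Data.Nat using (ℕ; zero; suc)
  open import Relation.Binary.PropositionalEquality as ≡ using (_≡_)
  open import Function using (_∘_)
  open import Data.List using ([]; _∷_; map; applyUpTo; length)
  open import Data.List.Relation.Unary.All using (All; []; _∷_)

  open Field F hiding (zero)
  open FieldOps F
  open import Relation.Binary.Reasoning.Setoid setoid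
  open import Algebra.Properties.Semiring.Exp semiring public using (^-congˡ; ^-assocʳ)
  open import Algebra.Properties.CommutativeSemiring.Exp commutativeSemiring public using (^-distrib-*)
  open RangeProducts *-commutativeMonoid public

  inverseˡ : ∀ x → ¬ (x ≈ 0#) → x ⁻¹ * x ≈ 1#
  inverseˡ x x≉0 = trans (*-comm _ _) (inverseʳ x x≉0)

  x*y≉0 : ∀ {x y} → ¬ (x ≈ 0#) → ¬ (y ≈ 0#) → ¬ (x * y ≈ 0#)
  x*y≉0 {x} {y} x≉0 y≉0 xy≈0 = y≉0 (begin
    y                 ≈⟨ sym (*-identityˡ y) ⟩
    1# * y            ≈⟨ *-congʳ (sym (inverseˡ x x≉0)) ⟩
    (x ⁻¹ * x) * y    ≈⟨ *-assoc _ _ _ ⟩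
    x ⁻¹ * (x * y)    ≈⟨ *-congˡ xy≈0 ⟩
    x ⁻¹ * 0#         ≈⟨ zeroʳ _ ⟩
    0#                ∎)

  *-cancelʳ-nonzero : ∀ {x y z} → ¬ (z ≈ 0#) → x * z ≈ y * z → x ≈ y
  *-cancelʳ-nonzero {x} {y} {z} z≉0 xz≈yz = begin
    x                 ≈⟨ sym (*-identityʳ x) ⟩
    x * 1#            ≈⟨ *-congˡ (sym (inverseʳ z z≉0)) ⟩
    x * (z * z ⁻¹)    ≈⟨ sym (*-assoc _ _ _) ⟩
    (x * z) * z ⁻¹    ≈⟨ *-congʳ xz≈yz ⟩
    (y * z) * z ⁻¹    ≈⟨ *-assoc _ _ _ ⟩
    y * (z * z ⁻¹)    ≈⟨ *-congˡ (inverseʳ z z≉0) ⟩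
    y * 1#            ≈⟨ *-identityʳ y ⟩
    y                 ∎

  inverse-unique : ∀ {x y z} → ¬ (z ≈ 0#) → x * z ≈ 1# → y * z ≈ 1# → x ≈ y
  inverse-unique z≉0 xz≈1 yz≈1 = *-cancelʳ-nonzero z≉0 (trans xz≈1 (sym yz≈1))

  ^-nonzero : ∀ x k → ¬ (x ≈ 0#) → ¬ (x ^ k ≈ 0#)
  ^-nonzero x zero x≉0 1≈0 = 0≉1 (sym 1≈0)
  ^-nonzero x (suc k) x≉0 = x*y≉0 x≉0 (^-nonzero x k x≉0)

  1^n≈1 : ∀ n → 1# ^ n ≈ 1#
  1^n≈1 zero = refl
  1^n≈1 (suc n) = trans (*-identityˡ _) (1^n≈1 n)

  ⁻¹-^ : ∀ x k → ¬ (x ≈ 0#) → (x ⁻¹) ^ k ≈ (x ^ k) ⁻¹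
  ⁻¹-^ x k x≉0 = inverse-unique (^-nonzero x k x≉0)
    (trans (sym (^-distrib-* (x ⁻¹) x k)) (trans (^-congˡ k (inverseˡ x x≉0)) (1^n≈1 k)))
    (inverseˡ (x ^ k) (^-nonzero x k x≉0))

  prodFrom≡∏< : ∀ lo len f → prodFrom lo len f ≡ ∏< len (λ j → f (lo N.+ j))
  prodFrom≡∏< lo len f = prodL-applyUpTo len (λ j → j)
    where
    prodL-applyUpTo : ∀ n (k : ℕ → ℕ) → prodL (map (λ j → f (lo N.+ j)) (applyUpTo k n)) ≡ ∏< n (λ j → f (lo N.+ k j))
    prodL-applyUpTo zero k = ≡.refl
    prodL-applyUpTo (suc n) k = ≡.cong (f (lo N.+ k 0) *_) (prodL-applyUpTo n (k ∘ suc))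

  sumL-map-const : ∀ {A : Set} (f : A → Carrier) y xs → All (λ x → f x ≈ y) xs → sumL (map f xs) ≈ length xs × y
  sumL-map-const f y [] [] = refl
  sumL-map-const f y (x ∷ xs) (fx≈y ∷ fxs≈y) = +-cong fx≈y (sumL-map-const f y xs fxs≈y)

  ∏<-nonzero : ∀ n h → (∀ j → ¬ (h j ≈ 0#)) → ¬ (∏< n h ≈ 0#)
  ∏<-nonzero zero h _ 1≈0 = 0≉1 (sym 1≈0)
  ∏<-nonzero (suc n) h h≉0 = x*y≉0 (h≉0 0) (∏<-nonzero n (h ∘ suc) (h≉0 ∘ suc))

module Fermat {c ℓ : Level} (F : Field c ℓ) where

  open import Data.Nat using (ℕ; zero; suc)
  open import Relation.Binary.PropositionalEquality as ≡ using (_≡_)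
  open import Function using (_∘_)
  open import Data.Fin as Fin using (Fin; zero; suc)
  open import Data.Fin.Permutation using (permutation)
  open import Data.Product using (proj₁; proj₂)
  open import Data.Bool using (if_then_else_)
  open import Relation.Nullary using (Dec; yes; no; does)
  open import Data.Empty using (⊥-elim)

  open Field F hiding (zero)
  open FieldOps F
  open FieldProperties F using (inverseˡ; x*y≉0; *-cancelʳ-nonzero; ^-congˡ)
  open import Relation.Binary.Reasoning.Setoid setoid
  open import Algebra.Properties.CommutativeMonoid.Sum *-commutativeMonoid
    renaming (sum to ∏) using (∑-distrib-+; sum-cong-≋; sum-permute)

  ∏-nonzero : ∀ m (f : Fin m → Carrier) → (∀ i → ¬ (f i ≈ 0#)) → ¬ (∏ f ≈ 0#)
  ∏-nonzero zero f _ 1≈0 = 0≉1 (sym 1≈0)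
  ∏-nonzero (suc m) f f≉0 = x*y≉0 (f≉0 zero) (∏-nonzero m (f ∘ suc) (f≉0 ∘ suc))

  oneAt : ∀ {m} → Fin m → (Fin m → Carrier) → Fin m → Carrier
  oneAt z f i = if does (i Fin.≟ z) then 1# else f i

  ∏-oneAt-const : ∀ m x (z : Fin (suc m)) → ∏ (oneAt z (λ _ → x)) ≈ x ^ m
  ∏-oneAt-const m x zero = trans (*-identityˡ _) (∏-const m)
    where
    ∏-const : ∀ m → ∏ {m} (λ _ → x) ≈ x ^ m
    ∏-const zero = refl
    ∏-const (suc m) = *-congˡ (∏-const m)
  ∏-oneAt-const (suc m) x (suc z) = *-congˡ (∏-oneAt-const m x z)

  module _ (m : ℕ) (card : HasCard F (suc m)) where

    private
      enum : Fin (suc m) → Carrier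
      enum = proj₁ card

      enum-injective : ∀ i j → enum i ≈ enum j → i ≡ j
      enum-injective = proj₁ (proj₂ card)

      index : Carrier → Fin (suc m)
      index x = proj₁ (proj₂ (proj₂ card) x)

      enum-index : ∀ x → enum (index x) ≈ x
      enum-index x = proj₂ (proj₂ (proj₂ card) x)

      z : Fin (suc m)
      z = index 0#

      enum≈0⇒≡z : ∀ i → enum i ≈ 0# → i ≡ z
      enum≈0⇒≡z i enum≈0 = enum-injective i z (trans enum≈0 (sym (enum-index 0#)))

      ≈0? : ∀ x → Dec (x ≈ 0#)
      ≈0? x with index x Fin.≟ z
      ... | yes ix≡z = yes (trans (sym (enum-index x)) (trans (reflexive (≡.cong enum ix≡z)) (enum-index 0#)))
      ... | no ix≢z = no (λ x≈0 → ix≢z (enum≈0⇒≡z (index x) (trans (enum-index x) x≈0)))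

      nonzeroOrOne : Fin (suc m) → Carrier
      nonzeroOrOne = oneAt z enum

      nonzeroOrOne≉0 : ∀ i → ¬ (nonzeroOrOne i ≈ 0#)
      nonzeroOrOne≉0 i with i Fin.≟ z
      ... | yes _ = λ 1≈0 → 0≉1 (sym 1≈0)
      ... | no i≢z = i≢z ∘ enum≈0⇒≡z i

    -- Multiplication by a unit permutes the nonzero elements.
    unit^m≈1 : ∀ a → ¬ (a ≈ 0#) → a ^ m ≈ 1#
    unit^m≈1 a a≉0 = begin
      a ^ m                   ≈⟨ sym (∏-oneAt-const m a z) ⟩
      ∏ (oneAt z (λ _ → a))   ≈⟨ *-cancelʳ-nonzero (∏-nonzero (suc m) nonzeroOrOne nonzeroOrOne≉0) products ⟩
      1#                      ∎
      where
      scale unscale : Fin (suc m) → Fin (suc m)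
      scale i = index (a * enum i)
      unscale i = index (a ⁻¹ * enum i)

      scale-unscale : ∀ i → scale (unscale i) ≡ i
      scale-unscale i = enum-injective _ _ (trans (enum-index _) (trans (*-congˡ (enum-index _))
        (trans (sym (*-assoc _ _ _)) (trans (*-congʳ (inverseʳ a a≉0)) (*-identityˡ _)))))

      unscale-scale : ∀ i → unscale (scale i) ≡ i
      unscale-scale i = enum-injective _ _ (trans (enum-index _) (trans (*-congˡ (enum-index _))
        (trans (sym (*-assoc _ _ _)) (trans (*-congʳ (inverseˡ a a≉0)) (*-identityˡ _)))))

      scale-z : scale z ≡ z
      scale-z = enum≈0⇒≡z _ (trans (enum-index _) (trans (*-congˡ (enum-index 0#)) (zeroʳ a)))

      nonzeroOrOne-scale : ∀ i → nonzeroOrOne (scale i) ≈ oneAt z (λ _ → a) i * nonzeroOrOne i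
      nonzeroOrOne-scale i with i Fin.≟ z
      ... | yes ≡.refl rewrite scale-z with z Fin.≟ z
      ...   | yes _ = sym (*-identityˡ _)
      ...   | no z≢z = ⊥-elim (z≢z ≡.refl)
      nonzeroOrOne-scale i | no i≢z with scale i Fin.≟ z
      ...   | yes si≡z = ⊥-elim (x*y≉0 a≉0 (i≢z ∘ enum≈0⇒≡z i)
                (trans (sym (enum-index _)) (trans (reflexive (≡.cong enum si≡z)) (enum-index 0#))))
      ...   | no _ = enum-index _

      products : ∏ (oneAt z (λ _ → a)) * ∏ nonzeroOrOne ≈ 1# * ∏ nonzeroOrOne
      products = begin
        ∏ (oneAt z (λ _ → a)) * ∏ nonzeroOrOne          ≈⟨ sym (∑-distrib-+ (oneAt z (λ _ → a)) nonzeroOrOne) ⟩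
        ∏ (λ i → oneAt z (λ _ → a) i * nonzeroOrOne i)  ≈⟨ sum-cong-≋ (λ i → sym (nonzeroOrOne-scale i)) ⟩
        ∏ (nonzeroOrOne ∘ scale)                        ≈⟨ sym (sum-permute nonzeroOrOne (permutation scale unscale scale-unscale unscale-scale)) ⟩
        ∏ nonzeroOrOne                                  ≈⟨ sym (*-identityˡ _) ⟩
        1# * ∏ nonzeroOrOne                             ∎

    x^[1+m]≈x : ∀ x → x ^ suc m ≈ x
    x^[1+m]≈x x with ≈0? x
    ... | yes x≈0 = trans (^-congˡ (suc m) x≈0) (trans (zeroˡ _) (sym x≈0))
    ... | no x≉0 = trans (*-congˡ (unit^m≈1 x x≉0)) (*-identityʳ x)

  x^∣F∣≈x : ∀ {k} → .{{N.NonZero k}} → HasCard F k → ∀ x → x ^ k ≈ x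
  x^∣F∣≈x {suc m} card = x^[1+m]≈x m card

module FrobeniusPowers {c ℓ : Level} (F : Field c ℓ) (q s n : ℕ)
    (x^qⁿ≈x : ∀ x → Field._≈_ F (FieldOps._^_ F x (q N.^ n)) x) where

  open import Data.Nat using (ℕ; zero; suc)
  open import Data.Product using (_,_)
  open import Relation.Binary.PropositionalEquality as ≡ using (_≡_)
  open import Function using (_∘_)
  open NatArithmetic using (_≡_[mod_])

  open Field F hiding (zero)
  open FieldOps F
  open FieldProperties F
  open Frob q s
  open import Relation.Binary.Reasoning.Setoid setoid

  σ^-+ : ∀ m k x → σ^ (m N.+ k) x ≡ σ^ m (σ^ k x)
  σ^-+ zero k x = ≡.refl
  σ^-+ (suc m) k x = ≡.cong σ (σ^-+ m k x)

  σ^-homo-* : ∀ m x y → σ^ m (x * y) ≈ σ^ m x * σ^ m y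
  σ^-homo-* zero x y = refl
  σ^-homo-* (suc m) x y = trans (^-congˡ (q N.^ s) (σ^-homo-* m x y)) (^-distrib-* _ _ (q N.^ s))

  σ^-1 : ∀ m → σ^ m 1# ≈ 1#
  σ^-1 zero = refl
  σ^-1 (suc m) = trans (^-congˡ (q N.^ s) (σ^-1 m)) (1^n≈1 (q N.^ s))

  σ^-nonzero : ∀ m x → ¬ (x ≈ 0#) → ¬ (σ^ m x ≈ 0#)
  σ^-nonzero zero x x≉0 = x≉0
  σ^-nonzero (suc m) x x≉0 = ^-nonzero _ (q N.^ s) (σ^-nonzero m x x≉0)

  σ^-⁻¹ : ∀ m x → ¬ (x ≈ 0#) → σ^ m (x ⁻¹) ≈ (σ^ m x) ⁻¹
  σ^-⁻¹ zero x x≉0 = refl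
  σ^-⁻¹ (suc m) x x≉0 = trans (^-congˡ (q N.^ s) (σ^-⁻¹ m x x≉0)) (⁻¹-^ _ (q N.^ s) (σ^-nonzero m x x≉0))

  σ^-∏< : ∀ m k h → σ^ m (∏< k h) ≈ ∏< k (σ^ m ∘ h)
  σ^-∏< m zero h = σ^-1 m
  σ^-∏< m (suc k) h = trans (σ^-homo-* m _ _) (*-congˡ (σ^-∏< m k (h ∘ suc)))

  σ^≈^ : ∀ m x → σ^ m x ≈ x ^ ((q N.^ s) N.^ m)
  σ^≈^ zero x = sym (*-identityʳ x)
  σ^≈^ (suc m) x = trans (^-congˡ (q N.^ s) (σ^≈^ m x))
    (trans (^-assocʳ x ((q N.^ s) N.^ m) (q N.^ s)) (reflexive (≡.cong (x ^_) (N.*-comm ((q N.^ s) N.^ m) (q N.^ s)))))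

  σ^n≈id : ∀ x → σ^ n x ≈ x
  σ^n≈id x = begin
    σ^ n x                      ≈⟨ σ^≈^ n x ⟩
    x ^ ((q N.^ s) N.^ n)        ≡⟨ ≡.cong (x ^_) (N.^-*-assoc q s n) ⟩
    x ^ (q N.^ (s N.* n))        ≡⟨ ≡.cong (λ k → x ^ (q N.^ k)) (N.*-comm s n) ⟩
    x ^ (q N.^ (n N.* s))        ≡⟨ ≡.cong (x ^_) (≡.sym (N.^-*-assoc q n s)) ⟩
    x ^ ((q N.^ n) N.^ s)        ≈⟨ fixed s ⟩
    x                           ∎
    where
    fixed : ∀ k → x ^ ((q N.^ n) N.^ k) ≈ x
    fixed zero = *-identityʳ x
    fixed (suc k) = trans (sym (^-assocʳ x (q N.^ n) ((q N.^ n) N.^ k))) (trans (^-congˡ ((q N.^ n) N.^ k) (x^qⁿ≈x x)) (fixed k))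

  σ^-periodic : ∀ m j x → σ^ (m N.+ j N.* n) x ≈ σ^ m x
  σ^-periodic m zero x = reflexive (≡.cong (λ k → σ^ k x) (N.+-identityʳ m))
  σ^-periodic m (suc j) x = begin
    σ^ (m N.+ (n N.+ j N.* n)) x   ≡⟨ ≡.cong (λ k → σ^ k x) (N.+-comm m (n N.+ j N.* n)) ⟩
    σ^ ((n N.+ j N.* n) N.+ m) x   ≡⟨ ≡.cong (λ k → σ^ k x) (N.+-assoc n (j N.* n) m) ⟩
    σ^ (n N.+ (j N.* n N.+ m)) x   ≡⟨ σ^-+ n _ x ⟩
    σ^ n (σ^ (j N.* n N.+ m) x)    ≈⟨ σ^n≈id _ ⟩
    σ^ (j N.* n N.+ m) x           ≡⟨ ≡.cong (λ k → σ^ k x) (N.+-comm (j N.* n) m) ⟩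
    σ^ (m N.+ j N.* n) x           ≈⟨ σ^-periodic m j x ⟩
    σ^ m x                         ∎

  σ^-mod : ∀ {k m} x → k ≡ m [mod n ] → σ^ k x ≈ σ^ m x
  σ^-mod {k} {m} x (i , j , eq) = trans (sym (σ^-periodic k i x)) (trans (reflexive (≡.cong (λ l → σ^ l x) eq)) (σ^-periodic m j x))

module Coefficients {c′ ℓ : Level} (F : Field c′ ℓ) (q s e : ℕ)
    (x^qⁿ≈x : ∀ x → Field._≈_ F (FieldOps._^_ F x (q N.^ (e N.+ e N.* N.suc e))) x)
    (a : Field.Carrier F) (a≉0 : ¬ Field._≈_ F a (Field.0# F)) where

  open import Data.Nat using (ℕ; suc; _∸_; _≤_; _<_; z≤n; s≤s)
  open import Data.List using (List; length; applyUpTo)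
  open import Data.Nat.ListAction using (sum)
  open import Data.Product using (_,_)
  import Data.List.Relation.Unary.All as All
  open import Relation.Binary.PropositionalEquality as ≡ using (_≡_)
  open import Function using (_∘_)
  open WeakCompositions
  open NatArithmetic

  open IndexArithmetic e
  open Field F
  open FieldOps F
  open FieldProperties F
  open FrobeniusPowers F q s n x^qⁿ≈x
  open Frob q s
  open Coeffs d a
  open import Relation.Binary.Reasoning.Setoid setoid
  import Algebra.Solver.CommutativeMonoid *-commutativeMonoid as *-Solver

  g : ℕ → Carrier
  g k = σ^ (d N.* k) a

  open Intervals g

  g-mod : ∀ {k m} → k ≡ m [mod n ] → g k ≈ g m
  g-mod k≡m = σ^-mod a (*-preserves-≡[mod] d k≡m)

  σ^a≈g : ∀ m → σ^ m a ≈ g (d N.* m)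
  σ^a≈g m = sym (σ^-mod a (d*[d*m]≡m m))

  ∏[,+⟩-nonzero : ∀ L len → ¬ (∏[ L ,+ len ⟩ ≈ 0#)
  ∏[,+⟩-nonzero L len = ∏<-nonzero len _ (λ k → σ^-nonzero (d N.* (L N.+ k)) a a≉0)

  ∏[,+⟩-mod : ∀ {L L′} len → L ≡ L′ [mod n ] → ∏[ L ,+ len ⟩ ≈ ∏[ L′ ,+ len ⟩
  ∏[,+⟩-mod len L≡L′ = ∏<-cong len (λ k _ → g-mod (+ʳ-preserves-≡[mod] k L≡L′))

  σ^b-cancels : ∀ m → σ^ m b * ∏[ d N.* m N.+ 1 ,+ e ⟩ ≈ 1#
  σ^b-cancels m = begin
    σ^ m b * ∏[ d N.* m N.+ 1 ,+ e ⟩                      ≈⟨ *-congʳ (trans (reflexive (≡.cong (σ^ m) (prodFrom≡∏< 1 e (λ i → σ^ (i N.* d) a ⁻¹)))) (σ^-∏< m e aInv)) ⟩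
    ∏< e (σ^ m ∘ aInv) * ∏[ d N.* m N.+ 1 ,+ e ⟩          ≈⟨ ∏<-inverse e _ _ cancel ⟩
    1#                                                    ∎
    where
    aInv : ℕ → Carrier
    aInv k = σ^ (suc k N.* d) a ⁻¹

    cancel : ∀ k → k < e → σ^ m (aInv k) * g (d N.* m N.+ 1 N.+ k) ≈ 1#
    cancel k _ = begin
      σ^ m (aInv k) * g (d N.* m N.+ 1 N.+ k)             ≈⟨ *-cong (σ^-⁻¹ m _ (σ^-nonzero (suc k N.* d) a a≉0)) (sym (g-mod (σ^b-index m k))) ⟩
      σ^ m (σ^ (suc k N.* d) a) ⁻¹ * g (d N.* (m N.+ suc k N.* d)) ≈⟨ *-congʳ (reflexive (≡.cong _⁻¹ (≡.sym (σ^-+ m (suc k N.* d) a)))) ⟩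
      σ^ (m N.+ suc k N.* d) a ⁻¹ * g (d N.* (m N.+ suc k N.* d))   ≈⟨ *-congˡ (sym (σ^a≈g (m N.+ suc k N.* d))) ⟩
      σ^ (m N.+ suc k N.* d) a ⁻¹ * σ^ (m N.+ suc k N.* d) a         ≈⟨ inverseˡ _ (σ^-nonzero (m N.+ suc k N.* d) a a≉0) ⟩
      1#                                                             ∎

  closedForm : ℕ → Carrier
  closedForm r = (prodFrom 1 (r ∸ 1) (λ v → σ^ ((r ∸ v) N.* d N.+ v ∸ 1) b)
                 * prodFrom 1 (r ∸ 1) (λ i → σ^ (i N.* d) a ⁻¹)) * a ⁻¹

  closedForm-inverse : ∀ t → closedForm (suc t) * ∏[ n ,+ suc t N.+ t N.* e ⟩ ≈ 1#
  closedForm-inverse t = begin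
    closedForm (suc t) * ∏[ n ,+ suc t N.+ t N.* e ⟩
      ≈⟨ *-cong (*-congʳ (reflexive (≡.cong₂ _*_ (prodFrom≡∏< 1 t bFactor) (prodFrom≡∏< 1 t aFactor)))) (∏[,+⟩-+ n (suc t) (t N.* e)) ⟩
    ((∏< t (bFactor ∘ suc) * ∏< t (aFactor ∘ suc)) * a ⁻¹) * ((g (n N.+ 0) * ∏< t gShifted) * ∏[ n N.+ suc t ,+ t N.* e ⟩)
      ≈⟨ *-congˡ (*-congˡ (∏[,+⟩-blocks t e (n N.+ suc t))) ⟩
    ((∏< t (bFactor ∘ suc) * ∏< t (aFactor ∘ suc)) * a ⁻¹) * ((g (n N.+ 0) * ∏< t gShifted) * ∏< t gBlock)
      ≈⟨ *-Solver.solve 6 (λ x y z u v w → ((x ⊕ y) ⊕ z) ⊕ ((u ⊕ v) ⊕ w) ⊜ (x ⊕ w) ⊕ ((y ⊕ v) ⊕ (z ⊕ u))) refl _ _ _ _ _ _ ⟩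
    (∏< t (bFactor ∘ suc) * ∏< t gBlock) * ((∏< t (aFactor ∘ suc) * ∏< t gShifted) * (a ⁻¹ * g (n N.+ 0)))
      ≈⟨ *-cong (∏<-inverse t _ _ b-cancels) (*-cong (∏<-inverse t _ _ a-cancels) a⁻¹-cancels) ⟩
    1# * (1# * 1#)
      ≈⟨ trans (*-identityˡ _) (*-identityˡ 1#) ⟩
    1#  ∎
    where
    open *-Solver using (_⊕_; _⊜_)

    bFactor aFactor gShifted gBlock : ℕ → Carrier
    bFactor v = σ^ ((suc t ∸ v) N.* d N.+ v ∸ 1) b
    aFactor i = σ^ (i N.* d) a ⁻¹
    gShifted v = g (n N.+ suc v)
    gBlock v = ∏[ n N.+ suc t N.+ v N.* e ,+ e ⟩

    b-cancels : ∀ v → v < t → bFactor (suc v) * gBlock v ≈ 1#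
    b-cancels v v<t = begin
      bFactor (suc v) * gBlock v
        ≡⟨ ≡.cong (λ m → σ^ m b * gBlock v) (≡.cong (_∸ 1) (N.+-suc ((t ∸ v) N.* d) v)) ⟩
      σ^ ((t ∸ v) N.* d N.+ v) b * gBlock v
        ≈⟨ *-congˡ (sym (∏[,+⟩-mod e index≡)) ⟩
      σ^ ((t ∸ v) N.* d N.+ v) b * ∏[ d N.* ((t ∸ v) N.* d N.+ v) N.+ 1 ,+ e ⟩
        ≈⟨ σ^b-cancels ((t ∸ v) N.* d N.+ v) ⟩
      1# ∎
      where
      index≡ : d N.* ((t ∸ v) N.* d N.+ v) N.+ 1 ≡ n N.+ suc t N.+ v N.* e [mod n ]
      index≡ = ≡.subst (λ k → d N.* ((t ∸ v) N.* d N.+ v) N.+ 1 ≡ n N.+ suc k N.+ v N.* e [mod n ])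
        (N.m∸n+n≡m (N.<⇒≤ v<t)) (closedForm-index (t ∸ v) v)

    a-cancels : ∀ v → v < t → aFactor (suc v) * gShifted v ≈ 1#
    a-cancels v _ = trans (*-congˡ (trans (g-mod (n+k≡k (suc v))) (reflexive (≡.cong (λ m → σ^ m a) (N.*-comm d (suc v))))))
                          (inverseˡ _ (σ^-nonzero (suc v N.* d) a a≉0))

    a⁻¹-cancels : a ⁻¹ * g (n N.+ 0) ≈ 1#
    a⁻¹-cancels = trans (*-congˡ (trans (g-mod (n+k≡k 0)) (reflexive (≡.cong (λ m → σ^ m a) (N.*-zeroʳ d))))) (inverseˡ a a≉0)

  module Summand (t : ℕ) (is : List ℕ) (1+t≤e : suc t ≤ e)
      (sum≡ : sum is ≡ e ∸ suc t) (length≡ : length is ≡ suc (suc t)) where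

    -- For is = (i₀, …, i_{t+1}): P r = i₀ + ⋯ + i_{r-1} and I r = i_r; block r and gapFactor u are
    -- the r-th product over j and the u-th power of b in the summand, and block r is the run of g over
    -- [blockStart r, blockStart r + i_r).
    P I : ℕ → ℕ
    P = psum is
    I = at is

    P-last : P (suc (suc t)) ≡ e ∸ suc t
    P-last = ≡.trans (≡.cong P (≡.sym length≡)) (≡.trans (psum-length is) sum≡)

    P≤e∸1+t : ∀ r → r ≤ suc t → P (suc r) ≤ e ∸ suc t
    P≤e∸1+t r r≤1+t = N.≤-trans (psum-mono is (s≤s r≤1+t)) (N.≤-reflexive P-last)

    P+I≤e∸1+t : ∀ r → r ≤ suc t → P r N.+ I r ≤ e ∸ suc t
    P+I≤e∸1+t r r≤1+t = N.≤-trans (N.≤-reflexive (≡.sym (psum-suc is r))) (P≤e∸1+t r r≤1+t)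

    blockStart : ℕ → ℕ
    blockStart r = n N.+ e N.* r ∸ P (suc r)

    blockStart+P : ∀ r → r ≤ suc t → blockStart r N.+ P (suc r) ≡ n N.+ e N.* r
    blockStart+P r r≤1+t = N.m∸n+n≡m (N.≤-trans (P≤e∸1+t r r≤1+t)
      (N.≤-trans (N.m∸n≤m e (suc t)) (N.≤-trans (N.m≤m+n e (e N.* d)) (N.m≤m+n n (e N.* r)))))

    block gapFactor : ℕ → Carrier
    block r = prodFrom 1 (I r) (λ j → σ^ (d N.* (d ∸ 1 ∸ r ∸ j ∸ P r) N.+ (d ∸ 1) N.+ r) a)
    gapFactor u = σ^ (d N.* (d ∸ 2 ∸ P (suc u) ∸ u) N.+ u N.+ (d ∸ 1)) b

    term≡ : term (suc t) is ≡ ∏< (suc (suc t)) block * ∏< (suc t) gapFactor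
    term≡ = ≡.cong₂ _*_ (prodFrom≡∏< 0 (suc (suc t)) block) (prodFrom≡∏< 0 (suc t) gapFactor)

    -- The factors of block r come in decreasing order of their index.
    block≈∏ : ∀ r → r ≤ suc t → block r ≈ ∏[ blockStart r ,+ I r ⟩
    block≈∏ r r≤1+t = begin
      block r                                              ≡⟨ prodFrom≡∏< 1 (I r) (λ j → σ^ (d N.* (e ∸ r ∸ j ∸ P r) N.+ e N.+ r) a) ⟩
      ∏< (I r) (λ j → σ^ (d N.* (e ∸ r ∸ suc j ∸ P r) N.+ e N.+ r) a) ≈⟨ ∏<-cong (I r) factor ⟩
      ∏< (I r) (λ j → g (blockStart r N.+ (I r ∸ 1 ∸ j)))   ≈⟨ ∏<-reverse (I r) (λ k → g (blockStart r N.+ k)) ⟩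
      ∏[ blockStart r ,+ I r ⟩                             ∎
      where
      factor : ∀ j → j < I r → σ^ (d N.* (e ∸ r ∸ suc j ∸ P r) N.+ e N.+ r) a ≈ g (blockStart r N.+ (I r ∸ 1 ∸ j))
      factor j j<I = trans (σ^a≈g (d N.* w N.+ e N.+ r))
        (g-mod (block-index w r j (P r) (I r ∸ 1 ∸ j) (blockStart r) w+r+j+P≡e s+P+k+j≡))
        where
        w = e ∸ r ∸ suc j ∸ P r
        w+r+j+P≡e : w N.+ r N.+ suc j N.+ P r ≡ e
        w+r+j+P≡e = ∸-∸-∸-+-+-+ r (suc j) (P r) (N.≤-trans (N.≤-reflexive (N.+-assoc r (suc j) (P r)))
          (+-≤-split r≤1+t (N.≤-trans (N.≤-reflexive (N.+-comm (suc j) (P r)))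
            (N.≤-trans (N.+-monoʳ-≤ (P r) j<I) (P+I≤e∸1+t r r≤1+t))) 1+t≤e))
        s+P+k+j≡ : blockStart r N.+ (P r N.+ (I r ∸ 1 ∸ j N.+ suc j)) ≡ n N.+ e N.* r
        s+P+k+j≡ = ≡.trans (≡.cong (λ k → blockStart r N.+ (P r N.+ k)) k+1+j≡I)
          (≡.trans (≡.cong (blockStart r N.+_) (≡.sym (psum-suc is r))) (blockStart+P r r≤1+t))
          where
          k+1+j≡I : I r ∸ 1 ∸ j N.+ suc j ≡ I r
          k+1+j≡I = ≡.trans (≡.cong (N._+ suc j) (N.∸-+-assoc (I r) 1 j)) (N.m∸n+n≡m j<I)

    gap-cancels : ∀ u → u < suc t → gapFactor u * ∏[ blockStart u ,+ e ⟩ ≈ 1#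
    gap-cancels u u<1+t = trans (*-congˡ (sym (∏[,+⟩-mod e index≡))) (σ^b-cancels (d N.* v N.+ u N.+ e))
      where
      v = e ∸ 1 ∸ P (suc u) ∸ u
      v+1+P+u≡e : v N.+ 1 N.+ P (suc u) N.+ u ≡ e
      v+1+P+u≡e = ∸-∸-∸-+-+-+ 1 (P (suc u)) u (N.≤-trans (N.≤-reflexive (≡.cong suc (N.+-comm (P (suc u)) u)))
        (+-≤-split u<1+t (P≤e∸1+t u (N.<⇒≤ u<1+t)) 1+t≤e))
      index≡ : d N.* (d N.* v N.+ u N.+ e) N.+ 1 ≡ blockStart u [mod n ]
      index≡ = gap-index v (P (suc u)) u (blockStart u) v+1+P+u≡e (blockStart+P u (N.<⇒≤ u<1+t))

    gapLength : ℕ → ℕ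
    gapLength u = e ∸ I (suc u)

    gapLength+I : ∀ u → u < suc t → gapLength u N.+ I (suc u) ≡ e
    gapLength+I u u<1+t = N.m∸n+n≡m (N.≤-trans (N.m≤n+m (I (suc u)) (P (suc u)))
      (N.≤-trans (P+I≤e∸1+t (suc u) u<1+t) (N.m∸n≤m e (suc t))))

    blockStart-adjacent : ∀ u → u < suc t → blockStart u N.+ gapLength u ≡ blockStart (suc u)
    blockStart-adjacent u u<1+t = next-start u (blockStart u) (blockStart (suc u)) (P (suc u)) (I (suc u)) (gapLength u)
      (blockStart+P u (N.<⇒≤ u<1+t))
      (≡.trans (≡.cong (blockStart (suc u) N.+_) (≡.sym (psum-suc is (suc u)))) (blockStart+P (suc u) u<1+t))
      (gapLength+I u u<1+t)

    neighbours-cancel : ∀ u → u < suc t → (block (suc u) * gapFactor u) * ∏[ blockStart u ,+ gapLength u ⟩ ≈ 1#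
    neighbours-cancel u u<1+t = begin
      (block (suc u) * gapFactor u) * ∏[ blockStart u ,+ gapLength u ⟩
        ≈⟨ trans (*-congʳ (*-comm _ _)) (*-assoc _ _ _) ⟩
      gapFactor u * (block (suc u) * ∏[ blockStart u ,+ gapLength u ⟩)
        ≈⟨ *-congˡ (trans (*-comm _ _) (*-congˡ (block≈∏ (suc u) u<1+t))) ⟩
      gapFactor u * (∏[ blockStart u ,+ gapLength u ⟩ * ∏[ blockStart (suc u) ,+ I (suc u) ⟩)
        ≡⟨ ≡.cong (λ L → gapFactor u * (∏[ blockStart u ,+ gapLength u ⟩ * ∏[ L ,+ I (suc u) ⟩)) (≡.sym (blockStart-adjacent u u<1+t)) ⟩
      gapFactor u * (∏[ blockStart u ,+ gapLength u ⟩ * ∏[ blockStart u N.+ gapLength u ,+ I (suc u) ⟩)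
        ≈⟨ *-congˡ (sym (∏[,+⟩-+ (blockStart u) (gapLength u) (I (suc u)))) ⟩
      gapFactor u * ∏[ blockStart u ,+ gapLength u N.+ I (suc u) ⟩
        ≡⟨ ≡.cong (λ len → gapFactor u * ∏[ blockStart u ,+ len ⟩) (gapLength+I u u<1+t) ⟩
      gapFactor u * ∏[ blockStart u ,+ e ⟩
        ≈⟨ gap-cancels u u<1+t ⟩
      1# ∎

    summand-inverse : term (suc t) is * ∏[ n ,+ suc t N.+ t N.* e ⟩ ≈ 1#
    summand-inverse = begin
      term (suc t) is * ∏[ n ,+ M ⟩
        ≡⟨ ≡.cong (_* ∏[ n ,+ M ⟩) term≡ ⟩
      ((block 0 * ∏< (suc t) (block ∘ suc)) * ∏< (suc t) gapFactor) * ∏[ n ,+ M ⟩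
        ≈⟨ *-Solver.solve 4 (λ x y z w → ((x ⊕ y) ⊕ z) ⊕ w ⊜ (y ⊕ z) ⊕ (x ⊕ w)) refl _ _ _ _ ⟩
      (∏< (suc t) (block ∘ suc) * ∏< (suc t) gapFactor) * (block 0 * ∏[ n ,+ M ⟩)
        ≈⟨ *-cong (sym (∏<-distrib (suc t) (block ∘ suc) gapFactor)) (*-congʳ (block≈∏ 0 z≤n)) ⟩
      ∏< (suc t) neighbours * (∏[ blockStart 0 ,+ I 0 ⟩ * ∏[ n ,+ M ⟩)
        ≡⟨ ≡.cong (λ L → ∏< (suc t) neighbours * (∏[ blockStart 0 ,+ I 0 ⟩ * ∏[ L ,+ M ⟩)) (≡.sym first-end) ⟩
      ∏< (suc t) neighbours * (∏[ blockStart 0 ,+ I 0 ⟩ * ∏[ blockStart 0 N.+ I 0 ,+ M ⟩)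
        ≈⟨ *-congˡ (sym (∏[,+⟩-+ (blockStart 0) (I 0) M)) ⟩
      ∏< (suc t) neighbours * ∏[ blockStart 0 ,+ I 0 N.+ M ⟩
        ≡⟨ ≡.cong (λ len → ∏< (suc t) neighbours * ∏[ blockStart 0 ,+ len ⟩) (≡.sym gaps≡) ⟩
      ∏< (suc t) neighbours * ∏[ blockStart 0 ,+ sum (applyUpTo gapLength (suc t)) ⟩
        ≈⟨ ∏[,+⟩-telescope (suc t) neighbours blockStart gapLength blockStart-adjacent neighbours-cancel ⟩
      1# ∎
      where
      open *-Solver using (_⊕_; _⊜_)
      M = suc t N.+ t N.* e

      neighbours : ℕ → Carrier
      neighbours u = block (suc u) * gapFactor u

      first-end : blockStart 0 N.+ I 0 ≡ n
      first-end = ≡.trans (≡.cong (blockStart 0 N.+_) (≡.sym (psum-suc is 0)))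
        (≡.trans (blockStart+P 0 z≤n) (≡.trans (≡.cong (n N.+_) (N.*-zeroʳ e)) (N.+-identityʳ n)))

      blockStart-last : blockStart (suc t) ≡ n N.+ M
      blockStart-last = last-start t (blockStart (suc t)) (P (suc (suc t))) (blockStart+P (suc t) N.≤-refl)
        (≡.trans (≡.cong (N._+ suc t) P-last) (N.m∸n+n≡m 1+t≤e))

      gaps≡ : sum (applyUpTo gapLength (suc t)) ≡ I 0 N.+ M
      gaps≡ = N.+-cancelˡ-≡ (blockStart 0) _ _
        (≡.trans (sum-lengths-telescope (suc t) blockStart gapLength blockStart-adjacent)
        (≡.trans blockStart-last (≡.trans (≡.cong (N._+ M) (≡.sym first-end)) (N.+-assoc (blockStart 0) (I 0) M))))

  summand≈closedForm : ∀ t is → suc t ≤ e → sum is ≡ e ∸ suc t → length is ≡ suc (suc t) → term (suc t) is ≈ closedForm (suc t)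
  summand≈closedForm t is 1+t≤e sum≡ length≡ =
    inverse-unique (∏[,+⟩-nonzero n (suc t N.+ t N.* e)) (Summand.summand-inverse t is 1+t≤e sum≡ length≡) (closedForm-inverse t)

  c≈C×closedForm : ∀ t → suc t ≤ e → c (suc t) ≈ (e C suc t) × closedForm (suc t)
  c≈C×closedForm t 1+t≤e = begin
    c (suc t)                                                     ≈⟨ sumL-map-const (term (suc t)) (closedForm (suc t)) compositions
                                                                       (All.zipWith (λ {is} (sum≡ , length≡) → summand≈closedForm t is 1+t≤e sum≡ length≡)
                                                                         (comps-sum (suc (suc t)) (e ∸ suc t) , comps-length (suc (suc t)) (e ∸ suc t))) ⟩
    length compositions × closedForm (suc t)                      ≡⟨ ≡.cong (_× closedForm (suc t)) (≡.trans (length-comps (suc t) (e ∸ suc t)) (≡.cong (_C suc t) (N.m∸n+n≡m 1+t≤e))) ⟩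
    (e C suc t) × closedForm (suc t)                              ∎
    where compositions = comps (suc (suc t)) (e ∸ suc t)

  closedForm-1 : closedForm 1 ≈ a ⁻¹
  closedForm-1 = trans (*-congʳ (*-identityˡ 1#)) (*-identityˡ (a ⁻¹))

primePower⇒nonZero : ∀ {q} → IsPrimePower q → N.NonZero q
primePower⇒nonZero (p P., k P., p-prime P., ≡.refl) = N.m^n≢0 p (N.suc k) {{prime⇒nonZero p-prime}}

lemma5p4 : {ℓ₁ ℓ₂ : Level} (q d n s : ℕ) → IsPrimePower q → 2 N.≤ d → n ≡ d N.* d N.∸ 1 → gcd s n ≡ 1 →
    (F : Field ℓ₁ ℓ₂) → HasCard F (q N.^ n) →
    let open Field F in
    let open FieldOps F in
    let open Frob q s in
    (a : Carrier) → ¬ (a ≈ 0#) →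
    let open Coeffs d a in
    (c 1 ≈ ((d N.∸ 1) C 1) × (a ⁻¹))
    P.× (∀ r → 2 N.≤ r → r N.≤ d N.∸ 1 →
      c r ≈ ((d N.∸ 1) C r) × ((prodFrom 1 (r N.∸ 1) (λ v → σ^ ((r N.∸ v) N.* d N.+ v N.∸ 1) b)
                              * prodFrom 1 (r N.∸ 1) (λ i → (σ^ (i N.* d) a) ⁻¹)) * (a ⁻¹)))
lemma5p4 q .(N.suc (N.suc f)) _ s q-primePower (N.s≤s (N.s≤s {n = f} N.z≤n)) ≡.refl _ F card a a≉0 =
  Field.trans F (c≈C×closedForm 0 (N.s≤s N.z≤n)) (×-congʳ (N.suc f C 1) closedForm-1) P.,
  λ { (N.suc t) _ 1+t≤e → c≈C×closedForm t 1+t≤e }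
  where
  open Field F using (+-monoid)
  open Mult +-monoid using (×-congʳ)
  open Coefficients F q s (N.suc f)
    (Fermat.x^∣F∣≈x F {{N.m^n≢0 q (N.suc f N.+ N.suc f N.* N.suc (N.suc f)) {{primePower⇒nonZero q-primePower}}}} card) a a≉0
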